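{- Let $M:\mathbb{N}\to\mathbb{U}$ be the map $M(n)=\mathbf{u}_n$. Then $M$ is a bijection and $M(m)\odot M(n)=M(m\cdot n)$ for all $m,n\in\mathbb{N}$. Thus $(\mathbb{N},\cdot)$ and $(\mathbb{U},\odot)$ are isomorphic.
   Context: For $n\in\mathbb{N}$, the natural wave number of wavelength $n$ is the sequence $\mathbf{u}_n=\big(e^{2\pi i k/n}\big)_{k\in\mathbb{Z}}$; $\mathbb{U}=\{\mathbf{u}_n:n\in\mathbb{N}\}$. For $m\ge1$, ${}_m\mathbf{u}_n$ denotes $\big(e^{2\pi i k/n}\big)_{1\le k\le mn}$. The circular product $\mathbf{u}_m\odot\mathbf{u}_n$ is the periodic sequence whose principal part (its first terms, which determine it by periodicity) is $\big({}_n\mathbf{u}_m\cdot{}_m\mathbf{u}_n\big)^{1/(n+m)}$, where $\cdot$ is the element-wise product over $1\le k\le mn$. The element-wise power acts on the exponent: $\big(e^{2\pi i(k/m+k/n)}\big)^{1/s}=e^{2\pi i(k/m+k/n)/s}$. -}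

module Defs where

open import Data.Nat using (ℕ; suc; NonZero) renaming (_+_ to _+ℕ_; _*_ to _*ℕ_)
open import Data.Nat.Properties using (m*n≢0)
open import Data.Integer using (ℤ; +_) renaming (_-_ to _-ℤ_)
open import Data.Integer.DivMod using (_%ℕ_)
open import Data.Rational using (ℚ; _/_; _+_; _-_; _*_)
open import Data.Product using (Σ; ∃-syntax; _,_; proj₁)
open import Relation.Binary.PropositionalEquality using (_≡_)

ℕ⁺ : Set
ℕ⁺ = Σ ℕ NonZero

_·⁺_ : ℕ⁺ → ℕ⁺ → ℕ⁺
(m , nm) ·⁺ (n , nn) = m *ℕ n , m*n≢0 m n {{nm}} {{nn}}

-- A point e^{2πi q} (q rational) of the unit circle is represented by its
-- exponent q ("angle in turns"); two exponents give the same complex number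
-- iff they differ by an integer.
_≈ᶜ_ : ℚ → ℚ → Set
q ≈ᶜ q' = ∃[ z ] (q - q' ≡ z / 1)

Seq : Set
Seq = ℤ → ℚ

_≈ˢ_ : Seq → Seq → Set
s ≈ˢ t = ∀ k → s k ≈ᶜ t k

u : ℕ⁺ → Seq
u (n , nz) k = (k / n) {{nz}}

𝕌 : Set
𝕌 = Σ Seq (λ s → ∃[ n ] (s ≈ˢ u n))

_≈ᵁ_ : 𝕌 → 𝕌 → Set
a ≈ᵁ b = proj₁ a ≈ˢ proj₁ b

M : ℕ⁺ → 𝕌
M n = u n , n , λ k → + 0 , Data.Rational.Properties.+-inverseʳ (u n k)
  where import Data.Rational.Properties

private
  sum≢0 : ∀ m n → .{{NonZero m}} → NonZero (m +ℕ n)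
  sum≢0 (suc m) n = _

-- Principal part of u_m ⊙ u_n, for 1 ≤ k ≤ mn:
--   (ₙu_m · ₘu_n)^{1/(n+m)} has exponent (k/m + k/n) / (n+m).
principal : ℕ⁺ → ℕ⁺ → ℕ → ℚ
principal m n k = (u m (+ k) + u n (+ k)) * (+ 1 / (proj₁ n +ℕ proj₁ m)) {{sum≢0 (proj₁ n) (proj₁ m) {{Data.Product.proj₂ n}}}}

-- The circular product u_m ⊙ u_n: the periodic sequence (period mn) on ℤ whose
-- terms at indices 1..mn are the principal part; index k is reduced to
-- ((k - 1) mod mn) + 1 ∈ {1,…,mn}.
circ : ℕ⁺ → ℕ⁺ → Seq
circ m n k = principal m n (suc (_%ℕ_ (k -ℤ + 1) (proj₁ (m ·⁺ n)) {{Data.Product.proj₂ (m ·⁺ n)}}))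

_⊙_ : 𝕌 → 𝕌 → Seq
(_ , m , _) ⊙ (_ , n , _) = circ m n

{-# OPTIONS --safe #-}
-- In exponent form the principal part of u_m ⊙ u_n is
-- (k/m + k/n)/(n+m) = k/(mn), the k-th term of u_{mn}, and reducing the
-- index k modulo mn changes k/(mn) only by an integer. If u_m and u_n agree,
-- then 1/m − 1/n is an integer, i.e. mn ∣ n − m, so m ∣ n and n ∣ m.
-- Surjectivity is built into the definition of 𝕌.
module Submission where

open import Defs
open import Data.Product using (_×_; ∃-syntax; proj₁; proj₂; _,_)
open import Data.Nat as ℕ using (suc; NonZero)
open import Data.Nat.Divisibility using (∣-antisym)
open import Data.Nat.Properties using (m*n≢0; m≤m+n; <-≤-trans)
open import Data.Integer using (+_; _+_; _*_; _-_; -_)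
open import Data.Integer.Divisibility.Signed
  using (_∣_; divides; ∣⇒∣ᵤ; ∣-refl; ∣-trans; ∣m⇒∣-m; ∣m⇒∣m*n; ∣n⇒∣m*n; ∣m+n∣n⇒∣m; ∣m+n∣m⇒∣n)
open import Data.Integer.DivMod using (_%ℕ_; _/ℕ_; a≡a%ℕn+[a/ℕn]*n)
open import Data.Integer.Properties
  using (pos-*; pos-+; *-identityˡ; *-identityʳ; *-assoc; neg-distribˡ-*; neg-involutive)
open import Data.Integer.Tactic.RingSolver using (solve-∀)
open import Data.Rational as ℚ using (_/_; toℚᵘ)
open import Data.Rational.Properties
  using (toℚᵘ-fromℚᵘ; toℚᵘ-injective; toℚᵘ-cong; toℚᵘ-homo-+; toℚᵘ-homo-*; toℚᵘ-homo‿-; /-cong; +-0-abelianGroup)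
open import Data.Rational.Unnormalised as ℚᵘ using (mkℚᵘ; *≡*)
import Data.Rational.Unnormalised.Properties as ℚᵘₚ
open import Algebra.Properties.AbelianGroup +-0-abelianGroup using (⁻¹-anti-homo‿-)
open import Relation.Binary.PropositionalEquality
  using (_≡_; refl; sym; trans; cong; cong₂; subst; module ≡-Reasoning)
open ≡-Reasoning

-- Identities between fractions i / n are transported from ℚᵘ, where i / n is
-- the unreduced pair and equality is cross-multiplication.
toℚᵘ-/ : ∀ i n .{{_ : NonZero n}} → toℚᵘ (i / n) ℚᵘ.≃ i ℚᵘ./ n
toℚᵘ-/ i (suc d) = toℚᵘ-fromℚᵘ (mkℚᵘ i d)

/≡/⇒*≡* : ∀ i j {m n} .{{_ : NonZero m}} .{{_ : NonZero n}} →
      i / m ≡ j / n → i * + n ≡ j * + m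
/≡/⇒*≡* i j {suc m} {suc n} eq
  with *≡* cross ← ℚᵘₚ.≃-trans (ℚᵘₚ.≃-sym (toℚᵘ-/ i (suc m)))
                                (ℚᵘₚ.≃-trans (toℚᵘ-cong eq) (toℚᵘ-/ j (suc n)))
  = cross

*≡*⇒/≡/ : ∀ i j {m n} .{{_ : NonZero m}} .{{_ : NonZero n}} →
      i * + n ≡ j * + m → i / m ≡ j / n
*≡*⇒/≡/ i j {suc m} {suc n} cross =
  toℚᵘ-injective (ℚᵘₚ.≃-trans (toℚᵘ-/ i (suc m))
                              (ℚᵘₚ.≃-trans (*≡* cross) (ℚᵘₚ.≃-sym (toℚᵘ-/ j (suc n)))))

/+/ : ∀ i j {m n} .{{_ : NonZero m}} .{{_ : NonZero n}} →
      i / m ℚ.+ j / n ≡ ((i * + n + j * + m) / (m ℕ.* n)) {{m*n≢0 m n}}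
/+/ i j {suc m} {suc n} = toℚᵘ-injective (ℚᵘₚ.≃-trans (toℚᵘ-homo-+ (i / suc m) (j / suc n))
  (ℚᵘₚ.≃-trans (ℚᵘₚ.+-cong (toℚᵘ-/ i (suc m)) (toℚᵘ-/ j (suc n)))
                (ℚᵘₚ.≃-sym (toℚᵘ-/ (i * + suc n + j * + suc m) (suc m ℕ.* suc n)))))

/*/ : ∀ i j {m n} .{{_ : NonZero m}} .{{_ : NonZero n}} →
      (i / m) ℚ.* (j / n) ≡ ((i * j) / (m ℕ.* n)) {{m*n≢0 m n}}
/*/ i j {suc m} {suc n} = toℚᵘ-injective (ℚᵘₚ.≃-trans (toℚᵘ-homo-* (i / suc m) (j / suc n))
  (ℚᵘₚ.≃-trans (ℚᵘₚ.*-cong (toℚᵘ-/ i (suc m)) (toℚᵘ-/ j (suc n)))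
                (ℚᵘₚ.≃-sym (toℚᵘ-/ (i * j) (suc m ℕ.* suc n)))))

neg-/ : ∀ i n .{{_ : NonZero n}} → ℚ.- (i / n) ≡ (- i) / n
neg-/ i (suc n) = toℚᵘ-injective (ℚᵘₚ.≃-trans (toℚᵘ-homo‿- (i / suc n))
  (ℚᵘₚ.≃-trans (ℚᵘₚ.-‿cong (toℚᵘ-/ i (suc n))) (ℚᵘₚ.≃-sym (toℚᵘ-/ (- i) (suc n)))))

/-/ : ∀ i j {m n} .{{_ : NonZero m}} .{{_ : NonZero n}} →
      i / m ℚ.- j / n ≡ ((i * + n - j * + m) / (m ℕ.* n)) {{m*n≢0 m n}}
/-/ i j {m} {n} = begin
  i / m ℚ.- j / n                                  ≡⟨ cong (i / m ℚ.+_) (neg-/ j n) ⟩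
  i / m ℚ.+ (- j) / n                              ≡⟨ /+/ i (- j) ⟩
  ((i * + n + - j * + m) / (m ℕ.* n)) {{m*n≢0 m n}}
    ≡⟨ /-cong {{m*n≢0 m n}} {{m*n≢0 m n}} (cong (_+_ (i * + n)) (sym (neg-distribˡ-* j (+ m)))) refl ⟩
  ((i * + n - j * + m) / (m ℕ.* n)) {{m*n≢0 m n}}    ∎

≈ᶜ-sym : ∀ {p q} → p ≈ᶜ q → q ≈ᶜ p
≈ᶜ-sym {p} {q} (z , p-q≡z) = - z , (begin
  q ℚ.- p         ≡⟨ sym (⁻¹-anti-homo‿- p q) ⟩
  ℚ.- (p ℚ.- q)   ≡⟨ cong ℚ.-_ p-q≡z ⟩
  ℚ.- (z / 1)     ≡⟨ neg-/ z 1 ⟩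
  (- z) / 1       ∎)

≈ˢ-sym : ∀ {s t} → s ≈ˢ t → t ≈ˢ s
≈ˢ-sym {s} {t} s≈t k = ≈ᶜ-sym {s k} {t k} (s≈t k)

/≈ᶜ/⇒∣ : ∀ i j {m n} .{{_ : NonZero m}} .{{_ : NonZero n}} →
      (i / m) ≈ᶜ (j / n) → + m * + n ∣ i * + n - j * + m
/≈ᶜ/⇒∣ i j {m} {n} (z , i/m-j/n≡z) = divides z (begin
  i * + n - j * + m             ≡⟨ sym (*-identityʳ _) ⟩
  (i * + n - j * + m) * + 1     ≡⟨ /≡/⇒*≡* (i * + n - j * + m) z {{m*n≢0 m n}} (trans (sym (/-/ i j)) i/m-j/n≡z) ⟩
  z * + (m ℕ.* n)               ≡⟨ cong (z *_) (pos-* m n) ⟩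
  z * (+ m * + n)               ∎)

∣⇒/≈ᶜ/ : ∀ i j {n} .{{_ : NonZero n}} → + n ∣ i - j → (i / n) ≈ᶜ (j / n)
∣⇒/≈ᶜ/ i j {n} (divides q i-j≡q*n) =
  q , trans (/-/ i j) (*≡*⇒/≡/ (i * + n - j * + n) q {{m*n≢0 n n}} cross)
  where
  factor : ∀ a b c → (a * c - b * c) * + 1 ≡ (a - b) * c
  factor = solve-∀

  cross : (i * + n - j * + n) * + 1 ≡ q * + (n ℕ.* n)
  cross = begin
    (i * + n - j * + n) * + 1   ≡⟨ factor i j (+ n) ⟩
    (i - j) * + n               ≡⟨ cong (_* + n) i-j≡q*n ⟩
    q * + n * + n               ≡⟨ *-assoc q (+ n) (+ n) ⟩
    q * (+ n * + n)             ≡⟨ cong (q *_) (sym (pos-* n n)) ⟩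
    q * + (n ℕ.* n)             ∎

m*n∣n-m⇒m≡n : ∀ m n → + m * + n ∣ + n - + m → m ≡ n
m*n∣n-m⇒m≡n m n mn∣n-m = ∣-antisym (∣⇒∣ᵤ m∣n) (∣⇒∣ᵤ n∣m)
  where
  m∣n : + m ∣ + n
  m∣n = ∣m+n∣n⇒∣m (∣-trans (∣m⇒∣m*n (+ n) ∣-refl) mn∣n-m) (∣m⇒∣-m ∣-refl)

  n∣m : + n ∣ + m
  n∣m = subst (+ n ∣_) (neg-involutive (+ m))
          (∣m⇒∣-m (∣m+n∣m⇒∣n (∣-trans (∣n⇒∣m*n (+ m) ∣-refl) mn∣n-m) ∣-refl))

u-injective : ∀ m n → u m ≈ˢ u n → proj₁ m ≡ proj₁ n
u-injective (m , m≢0) (n , n≢0) u≈u = m*n∣n-m⇒m≡n m n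
  (subst (+ m * + n ∣_) (cong₂ _-_ (*-identityˡ (+ n)) (*-identityˡ (+ m)))
    (/≈ᶜ/⇒∣ (+ 1) (+ 1) {{m≢0}} {{n≢0}} (u≈u (+ 1))))

principal≡u : ∀ m n j → principal m n j ≡ u (m ·⁺ n) (+ j)
principal≡u (m , m≢0) (n , n≢0) j = begin
  (+ j / m ℚ.+ + j / n) ℚ.* (+ 1 / (n ℕ.+ m))                      ≡⟨ cong (ℚ._* (+ 1 / (n ℕ.+ m))) (/+/ (+ j) (+ j)) ⟩
  ((+ j * + n + + j * + m) / (m ℕ.* n)) ℚ.* (+ 1 / (n ℕ.+ m))      ≡⟨ /*/ (+ j * + n + + j * + m) (+ 1) ⟩
  ((+ j * + n + + j * + m) * + 1) / (m ℕ.* n ℕ.* (n ℕ.+ m))        ≡⟨ *≡*⇒/≡/ ((+ j * + n + + j * + m) * + 1) (+ j) cross ⟩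
  + j / (m ℕ.* n)                                                  ∎
  where
  instance
    _ = m≢0
    _ = n≢0
    _ = m*n≢0 m n
    n+m≢0 : NonZero (n ℕ.+ m)
    n+m≢0 = ℕ.>-nonZero (<-≤-trans (ℕ.>-nonZero⁻¹ n) (m≤m+n n m))
    _ = m*n≢0 (m ℕ.* n) (n ℕ.+ m)

  regroup : ∀ j m n → ((j * n + j * m) * + 1) * (m * n) ≡ j * ((m * n) * (n + m))
  regroup = solve-∀

  cross : ((+ j * + n + + j * + m) * + 1) * + (m ℕ.* n) ≡ + j * + (m ℕ.* n ℕ.* (n ℕ.+ m))
  cross = begin
    ((+ j * + n + + j * + m) * + 1) * + (m ℕ.* n)     ≡⟨ cong (((+ j * + n + + j * + m) * + 1) *_) (pos-* m n) ⟩
    ((+ j * + n + + j * + m) * + 1) * (+ m * + n)     ≡⟨ regroup (+ j) (+ m) (+ n) ⟩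
    + j * ((+ m * + n) * (+ n + + m))                 ≡⟨ cong (+ j *_) (cong₂ _*_ (pos-* m n) (pos-+ n m)) ⟨
    + j * (+ (m ℕ.* n) * + (n ℕ.+ m))                 ≡⟨ cong (+ j *_) (pos-* (m ℕ.* n) (n ℕ.+ m)) ⟨
    + j * + (m ℕ.* n ℕ.* (n ℕ.+ m))                   ∎

circ≈ˢu : ∀ m n → circ m n ≈ˢ u (m ·⁺ n)
circ≈ˢu m n k =
  subst (_≈ᶜ u (m ·⁺ n) k) (sym (principal≡u m n (suc r)))
        (∣⇒/≈ᶜ/ (+ suc r) k (divides (- q) 1+r-k≡-q*mn))
  where
  mn = proj₁ (m ·⁺ n)
  instance _ = proj₂ (m ·⁺ n)
  r = (k - + 1) %ℕ mn
  q = (k - + 1) /ℕ mn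

  regroup₁ : ∀ r k → + 1 + r - k ≡ r - (k - + 1)
  regroup₁ = solve-∀

  regroup₂ : ∀ r q n → r - (r + q * n) ≡ - q * n
  regroup₂ = solve-∀

  1+r-k≡-q*mn : + suc r - k ≡ - q * + mn
  1+r-k≡-q*mn = begin
    + 1 + + r - k             ≡⟨ regroup₁ (+ r) k ⟩
    + r - (k - + 1)           ≡⟨ cong (_-_ (+ r)) (a≡a%ℕn+[a/ℕn]*n (k - + 1) mn) ⟩
    + r - (+ r + q * + mn)    ≡⟨ regroup₂ (+ r) q (+ mn) ⟩
    - q * + mn                ∎

M-surjective : (w : 𝕌) → ∃[ n ] (M n ≈ᵁ w)
M-surjective (s , n , s≈uₙ) = n , ≈ˢ-sym {s} {u n} s≈uₙ

mainTheorem2 : ((m n : ℕ⁺) → M m ≈ᵁ M n → proj₁ m ≡ proj₁ n)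
    × ((w : 𝕌) → ∃[ n ] (M n ≈ᵁ w))
    × ((m n : ℕ⁺) → (M m ⊙ M n) ≈ˢ proj₁ (M (m ·⁺ n)))
mainTheorem2 = u-injective , M-surjective , circ≈ˢu
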